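{- Let $G$ be a connected loopless MP-digraph that is not a coherently oriented cycle, and suppose that $G$ has a unique dynamical module. Then $G$ is a sink or a source (in the sense below).
   Context: Digraphs: finite, at most one edge $(v,w)$ from $v$ to $w$ for distinct $v,w$. A coherently oriented cycle of length $n\ge2$ has distinct vertices $v_1,\dots,v_n$ and edges $(v_i,v_{i+1})$, $(v_n,v_1)$. An MP-digraph satisfies (MP1) no subgraph isomorphic to $D_A$ (vertices $v_0,v_1,v_2$, edges $(v_1,v_0),(v_0,v_2),(v_1,v_2)$) or $D_B$ (vertices $v_0,\dots,v_3$, edges $(v_0,v_1),(v_2,v_1),(v_2,v_3)$) or their edge-reversals, and (MP2) every coherently oriented cycle of length $\ge 2$ is a connected component. For $G'\le G$, the complement $C_G(G')$ is the subgraph spanned by $E(G)\setminus E(G')$, and the boundary is $\partial G'=V(G')\cap V(C_G(G'))$. In a digraph with at least one edge, a vertex is stable if its indegree or its outdegree is zero, unstable otherwise. A dynamical region of $G$ is a connected subgraph $R$ with at least one edge such that (a) every vertex of $\partial R$ is unstable in $G$ but stable in $R$ and in $C_G(R)$, and (b) no edge of $R$ lies on an oriented cycle of $G$ not contained in $R$. A dynamical module is a minimal (by inclusion) dynamical region. A vertex $v$ is a sink (resp. source) if every edge incident to it has $v$ as target (resp. source) and is not a loop. A digraph with $n$ edges is a sink (resp. source) on $n+1$ vertices if it has a unique sink (resp. source) vertex and every edge is incident to it. -}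

module Defs where

open import Data.Nat using (ℕ; suc)
open import Data.Fin using (Fin; zero; suc; inject₁; fromℕ)
open import Data.Bool using (Bool; true; false; _∧_; not; T)
open import Data.Product using (Σ; ∃; ∃-syntax; _×_; _,_)
open import Data.Sum using (_⊎_)
open import Data.Empty using (⊥)
open import Relation.Nullary using (¬_)
open import Relation.Binary.PropositionalEquality using (_≡_)
open import Relation.Binary.Construct.Closure.ReflexiveTransitive using (Star)
open import Function.Definitions using (Injective)

-- A finite digraph on the vertex set Fin n is given by its edge
-- relation  E : Fin n → Fin n → Bool  (E u v = true iff (u,v) is an edge;
-- at most one edge per ordered pair is automatic).
EdgeSet : ℕ → Set
EdgeSet n = Fin n → Fin n → Bool

module _ {n : ℕ} where

  Loopless : EdgeSet n → Set
  Loopless E = ∀ v → E v v ≡ false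

  _⊆E_ : EdgeSet n → EdgeSet n → Set
  H ⊆E K = ∀ u v → T (H u v) → T (K u v)

  HasEdge : EdgeSet n → Set
  HasEdge H = ∃[ u ] ∃[ v ] T (H u v)

  -- vertex set of the subgraph spanned by the edge set H
  InV : EdgeSet n → Fin n → Set
  InV H v = ∃[ u ] (T (H v u) ⊎ T (H u v))

  Adj : EdgeSet n → Fin n → Fin n → Set
  Adj H u v = T (H u v) ⊎ T (H v u)

  Walk : EdgeSet n → Fin n → Fin n → Set
  Walk H = Star (Adj H)

  ConnectedDigraph : EdgeSet n → Set
  ConnectedDigraph E = ∀ u v → Walk E u v

  ConnectedSub : EdgeSet n → Set
  ConnectedSub H = ∀ u v → InV H u → InV H v → Walk H u v

  Compl : EdgeSet n → EdgeSet n → EdgeSet n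
  Compl E R u v = E u v ∧ not (R u v)

  Boundary : EdgeSet n → EdgeSet n → Fin n → Set
  Boundary E R v = InV R v × InV (Compl E R) v

  Stable : EdgeSet n → Fin n → Set
  Stable H v = (∀ u → H u v ≡ false) ⊎ (∀ u → H v u ≡ false)

  Unstable : EdgeSet n → Fin n → Set
  Unstable H v = ¬ Stable H v

  -- coherently oriented cycle of length 2 + len ≥ 2 in E:
  -- distinct vertices vs 0, …, vs (len+1) with edges vs i → vs (i+1)
  -- and vs (len+1) → vs 0.
  record Cycle (E : EdgeSet n) : Set where
    field
      len   : ℕ
      vs    : Fin (suc (suc len)) → Fin n
      inj   : Injective _≡_ _≡_ vs
      step  : ∀ (i : Fin (suc len)) → T (E (vs (inject₁ i)) (vs (suc i)))
      close : T (E (vs (fromℕ (suc len))) (vs zero))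

  module _ {E : EdgeSet n} where
    CycleEdge : Cycle E → Fin n → Fin n → Set
    CycleEdge c u v =
      (∃[ i ] (u ≡ Cycle.vs c (inject₁ i) × v ≡ Cycle.vs c (suc i)))
      ⊎ (u ≡ Cycle.vs c (fromℕ (suc (Cycle.len c))) × v ≡ Cycle.vs c zero)

    CycleVertex : Cycle E → Fin n → Set
    CycleVertex c v = ∃[ i ] Cycle.vs c i ≡ v

  -- a subgraph of E with vertex set V and edge set F is a connected
  -- component of E: it is a connected subgraph and every edge of E
  -- incident to one of its vertices belongs to it (i.e. it is a maximal
  -- connected subgraph).
  IsComponent : EdgeSet n → (Fin n → Set) → (Fin n → Fin n → Set) → Set
  IsComponent E V F =
    (∀ u v → F u v → T (E u v) × V u × V v)
    × (∀ u v → V u → V v → Star (λ a b → F a b ⊎ F b a) u v)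
    × (∀ u v → T (E u v) → (V u ⊎ V v) → F u v)

  -- (MP1): no subgraph isomorphic to D_A, D_B or their edge reversals
  NoDA : EdgeSet n → Set
  NoDA E = ∀ v0 v1 v2 → ¬ (v0 ≡ v1) → ¬ (v0 ≡ v2) → ¬ (v1 ≡ v2) →
           ¬ (T (E v1 v0) × T (E v0 v2) × T (E v1 v2))

  NoDArev : EdgeSet n → Set
  NoDArev E = ∀ v0 v1 v2 → ¬ (v0 ≡ v1) → ¬ (v0 ≡ v2) → ¬ (v1 ≡ v2) →
              ¬ (T (E v0 v1) × T (E v2 v0) × T (E v2 v1))

  Distinct4 : Fin n → Fin n → Fin n → Fin n → Set
  Distinct4 a b c d = ¬ (a ≡ b) × ¬ (a ≡ c) × ¬ (a ≡ d)
                      × ¬ (b ≡ c) × ¬ (b ≡ d) × ¬ (c ≡ d)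

  NoDB : EdgeSet n → Set
  NoDB E = ∀ v0 v1 v2 v3 → Distinct4 v0 v1 v2 v3 →
           ¬ (T (E v0 v1) × T (E v2 v1) × T (E v2 v3))

  NoDBrev : EdgeSet n → Set
  NoDBrev E = ∀ v0 v1 v2 v3 → Distinct4 v0 v1 v2 v3 →
              ¬ (T (E v1 v0) × T (E v1 v2) × T (E v3 v2))

  MP1 : EdgeSet n → Set
  MP1 E = NoDA E × NoDArev E × NoDB E × NoDBrev E

  MP2 : EdgeSet n → Set
  MP2 E = ∀ (c : Cycle E) → IsComponent E (CycleVertex c) (CycleEdge c)

  MPDigraph : EdgeSet n → Set
  MPDigraph E = MP1 E × MP2 E

  IsCycleDigraph : EdgeSet n → Set
  IsCycleDigraph E = Σ (Cycle E) λ c →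
    (∀ v → CycleVertex c v) × (∀ u v → T (E u v) → CycleEdge c u v)

  DynRegion : EdgeSet n → EdgeSet n → Set
  DynRegion E R =
    R ⊆E E
    × HasEdge R
    × ConnectedSub R
    × (∀ v → Boundary E R v →
         Unstable E v × Stable R v × Stable (Compl E R) v)
    × (∀ (c : Cycle E) → (∃[ u ] ∃[ v ] (CycleEdge c u v × T (R u v))) →
         ∀ u v → CycleEdge c u v → T (R u v))

  DynModule : EdgeSet n → EdgeSet n → Set
  DynModule E R =
    DynRegion E R
    × (∀ R' → DynRegion E R' → R' ⊆E R → ∀ u v → R' u v ≡ R u v)

  UniqueDynModule : EdgeSet n → Set
  UniqueDynModule E = Σ (EdgeSet n) λ R →
    DynModule E R × (∀ R' → DynModule E R' → ∀ u v → R' u v ≡ R u v)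

  SinkVertex : EdgeSet n → Fin n → Set
  SinkVertex E v = ∀ u → E v u ≡ false

  SourceVertex : EdgeSet n → Fin n → Set
  SourceVertex E v = ∀ u → E u v ≡ false

  IsSinkDigraph : EdgeSet n → Set
  IsSinkDigraph E = Σ (Fin n) λ c →
    SinkVertex E c × (∀ v → SinkVertex E v → v ≡ c)
    × (∀ u v → T (E u v) → (u ≡ c ⊎ v ≡ c))

  IsSourceDigraph : EdgeSet n → Set
  IsSourceDigraph E = Σ (Fin n) λ c →
    SourceVertex E c × (∀ v → SourceVertex E v → v ≡ c)
    × (∀ u v → T (E u v) → (u ≡ c ⊎ v ≡ c))

{-# OPTIONS --safe #-}
module Submission where

-- G has no oriented cycle: by (MP2) and connectedness such a cycle would be all of G.
-- For every edge (p, q), the fan of all edges leaving p or entering q is then a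
-- dynamical module.  Its boundary conditions come from (MP1): D_A and D_B forbid an
-- edge outside the fan to leave a vertex w with an edge w → q, or to enter a vertex
-- w with an edge p → w.  It is minimal because a dynamical region containing an
-- edge contains every edge of G with the same tail and every edge with the same head.
-- Uniqueness of the module makes all fans equal, so any two edges share their tail
-- or their head, and a connected loopless digraph with this property is a sink or a
-- source.

open import Defs
open import Data.Nat using (ℕ)
open import Data.Fin using (Fin; _≟_; zero)
open import Data.Fin.Properties using (any?)
open import Data.Bool using (true; false; _∧_; _∨_; T)
open import Data.Bool.Properties using (T-∧; T-∨; T-not-≡)
open import Data.Empty using (⊥; ⊥-elim)
open import Data.Product using (_×_; _,_; proj₁; proj₂)
open import Data.Sum using (_⊎_; inj₁; inj₂; [_,_]; swap) renaming (map to ⊎-map)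
open import Function using (_∘_; flip; Equivalence)
open import Relation.Nullary using (¬_; yes; no)
open import Relation.Nullary.Decidable
  using (⌊_⌋; toWitness; fromWitness; T?; ¬?; _×-dec_; decidable-stable)
open import Relation.Binary.PropositionalEquality using (_≡_; _≢_; refl; sym; trans; subst)
open import Relation.Binary.Construct.Closure.ReflexiveTransitive
  using (ε; _◅_; _◅◅_; reverse; map)

open Equivalence using (to; from)

¬T⇒≡false : ∀ {b} → ¬ T b → b ≡ false
¬T⇒≡false {false} _  = refl
¬T⇒≡false {true}  ¬t = ⊥-elim (¬t _)

≡false⇒¬T : ∀ {b} → b ≡ false → ¬ T b
≡false⇒¬T refl ()

T-extensional : ∀ {a b} → (T a → T b) → (T b → T a) → a ≡ b
T-extensional {false} {false} _ _ = refl
T-extensional {false} {true}  _ g = ⊥-elim (g _)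
T-extensional {true}  {false} f _ = ⊥-elim (f _)
T-extensional {true}  {true}  _ _ = refl

module _ {n : ℕ} where

  Walk-reverse : ∀ {H : EdgeSet n} {u v} → Walk H u v → Walk H v u
  Walk-reverse = reverse swap

  Walk-flip : ∀ {H : EdgeSet n} {u v} → Walk H u v → Walk (flip H) u v
  Walk-flip = map swap

  Loopless-≢ : ∀ {E : EdgeSet n} → Loopless E → ∀ {u v} → T (E u v) → u ≢ v
  Loopless-≢ loopless {u} e refl = ≡false⇒¬T (loopless u) e

  noIn⇒Stable : ∀ {H : EdgeSet n} {v} → (∀ u → ¬ T (H u v)) → Stable H v
  noIn⇒Stable noIn = inj₁ (¬T⇒≡false ∘ noIn)

  noOut⇒Stable : ∀ {H : EdgeSet n} {v} → (∀ u → ¬ T (H v u)) → Stable H v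
  noOut⇒Stable noOut = inj₂ (¬T⇒≡false ∘ noOut)

  Unstable-through : ∀ {H : EdgeSet n} {u v w} → T (H u v) → T (H v w) → Unstable H v
  Unstable-through huv _   (inj₁ noIn)  = ≡false⇒¬T (noIn _) huv
  Unstable-through _   hvw (inj₂ noOut) = ≡false⇒¬T (noOut _) hvw

  module ComplementMembership (E R : EdgeSet n) {u v : Fin n} where

    Compl-intro : T (E u v) → ¬ T (R u v) → T (Compl E R u v)
    Compl-intro e ¬r = from T-∧ (e , from T-not-≡ (¬T⇒≡false ¬r))

    Compl-elim : T (Compl E R u v) → T (E u v) × ¬ T (R u v)
    Compl-elim k with to T-∧ k
    ... | e , notR = e , ≡false⇒¬T (to T-not-≡ notR)

    R-or-Compl : T (E u v) → T (R u v) ⊎ T (Compl E R u v)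
    R-or-Compl e with T? (R u v)
    ... | yes r = inj₁ r
    ... | no ¬r = inj₂ (Compl-intro e ¬r)

    neither-R-nor-Compl : ¬ T (R u v) → ¬ T (Compl E R u v) → ¬ T (E u v)
    neither-R-nor-Compl ¬r ¬k e = [ ¬r , ¬k ] (R-or-Compl e)

  module _ {E : EdgeSet n} (connected : ConnectedDigraph E) (mp2 : MP2 E) where

    Cycle⇒IsCycleDigraph : Cycle E → IsCycleDigraph E
    Cycle⇒IsCycleDigraph c = c , onCycle , λ u v e → closed u v e (inj₁ (onCycle u))
      where
      edgeEnds : ∀ u v → CycleEdge c u v → T (E u v) × CycleVertex c u × CycleVertex c v
      edgeEnds = proj₁ (mp2 c)

      closed : ∀ u v → T (E u v) → CycleVertex c u ⊎ CycleVertex c v → CycleEdge c u v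
      closed = proj₂ (proj₂ (mp2 c))

      walkStaysOnCycle : ∀ {x y} → CycleVertex c x → Walk E x y → CycleVertex c y
      walkStaysOnCycle onX ε = onX
      walkStaysOnCycle onX (inj₁ e ◅ w) =
        walkStaysOnCycle (proj₂ (proj₂ (edgeEnds _ _ (closed _ _ e (inj₁ onX))))) w
      walkStaysOnCycle onX (inj₂ e ◅ w) =
        walkStaysOnCycle (proj₁ (proj₂ (edgeEnds _ _ (closed _ _ e (inj₂ onX))))) w

      onCycle : ∀ v → CycleVertex c v
      onCycle v = walkStaysOnCycle (zero , refl) (connected _ v)

  -- A boundary vertex is stable in R and in its complement but not in G, so R and
  -- its complement cannot both leave it (or both enter it).
  module _ {E R : EdgeSet n} (region : DynRegion E R) where

    open ComplementMembership E R

    private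
      boundaryCondition : ∀ v → Boundary E R v →
                          Unstable E v × Stable R v × Stable (Compl E R) v
      boundaryCondition = proj₁ (proj₂ (proj₂ (proj₂ region)))

    DynRegion-noCommonTail : ∀ {x y z} → T (R x y) → ¬ T (Compl E R x z)
    DynRegion-noCommonTail {x} {y} {z} rxy kxz
      with boundaryCondition x ((y , inj₁ rxy) , (z , inj₁ kxz))
    ... | _ , inj₂ noOutR , _ = ≡false⇒¬T (noOutR y) rxy
    ... | _ , inj₁ _ , inj₂ noOutK = ≡false⇒¬T (noOutK z) kxz
    ... | unstable , inj₁ noInR , inj₁ noInK = unstable (noIn⇒Stable {H = E} λ u →
          neither-R-nor-Compl (≡false⇒¬T (noInR u)) (≡false⇒¬T (noInK u)))

    DynRegion-noCommonHead : ∀ {x y z} → T (R y x) → ¬ T (Compl E R z x)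
    DynRegion-noCommonHead {x} {y} {z} ryx kzx
      with boundaryCondition x ((y , inj₂ ryx) , (z , inj₂ kzx))
    ... | _ , inj₁ noInR , _ = ≡false⇒¬T (noInR y) ryx
    ... | _ , inj₂ _ , inj₁ noInK = ≡false⇒¬T (noInK z) kzx
    ... | unstable , inj₂ noOutR , inj₂ noOutK = unstable (noOut⇒Stable {H = E} λ u →
          neither-R-nor-Compl (≡false⇒¬T (noOutR u)) (≡false⇒¬T (noOutK u)))

    DynRegion-tailClosed : ∀ {x y z} → T (R x y) → T (E x z) → T (R x z)
    DynRegion-tailClosed rxy exz with R-or-Compl exz
    ... | inj₁ rxz = rxz
    ... | inj₂ kxz = ⊥-elim (DynRegion-noCommonTail rxy kxz)

    DynRegion-headClosed : ∀ {x y z} → T (R y x) → T (E z x) → T (R z x)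
    DynRegion-headClosed ryx ezx with R-or-Compl ezx
    ... | inj₁ rzx = rzx
    ... | inj₂ kzx = ⊥-elim (DynRegion-noCommonHead ryx kzx)

  -- The distinctness conditions of D_B that are not assumed follow from looplessness
  -- and the absence of transitive triangles.
  module _ {E : EdgeSet n} (loopless : Loopless E) (mp1 : MP1 E) where

    noTransitiveTriangle : ∀ {a b c} → T (E a b) → T (E b c) → ¬ T (E a c)
    noTransitiveTriangle eab ebc eac =
      proj₁ mp1 _ _ _ (Loopless-≢ loopless eab ∘ sym) (Loopless-≢ loopless ebc)
        (Loopless-≢ loopless eac) (eab , ebc , eac)

    noDB : ∀ {a b c d} → T (E a b) → T (E c b) → T (E c d) → a ≢ c → b ≢ d → ⊥
    noDB eab ecb ecd a≢c b≢d = proj₁ (proj₂ (proj₂ mp1)) _ _ _ _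
      ( Loopless-≢ loopless eab , a≢c , (λ { refl → noTransitiveTriangle ecd eab ecb })
      , Loopless-≢ loopless ecb ∘ sym , b≢d , Loopless-≢ loopless ecd )
      (eab , ecb , ecd)

    noDBrev : ∀ {a b c d} → T (E b a) → T (E b c) → T (E d c) → a ≢ c → b ≢ d → ⊥
    noDBrev eba ebc edc a≢c b≢d = proj₂ (proj₂ (proj₂ mp1)) _ _ _ _
      ( Loopless-≢ loopless eba ∘ sym , a≢c , (λ { refl → noTransitiveTriangle eba edc ebc })
      , Loopless-≢ loopless ebc , b≢d , Loopless-≢ loopless edc ∘ sym )
      (eba , ebc , edc)

Fan : ∀ {n} → EdgeSet n → Fin n → Fin n → EdgeSet n
Fan E p q u w = E u w ∧ (⌊ u ≟ p ⌋ ∨ ⌊ w ≟ q ⌋)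

module FanEdges {n : ℕ} {E : EdgeSet n} {p q : Fin n} where

  Fan-intro : ∀ {u w} → T (E u w) → u ≡ p ⊎ w ≡ q → T (Fan E p q u w)
  Fan-intro {u} {w} e atEnd =
    from T-∧ (e , from T-∨ (⊎-map (fromWitness {a? = u ≟ p}) (fromWitness {a? = w ≟ q}) atEnd))

  Fan-elim : ∀ {u w} → T (Fan E p q u w) → T (E u w) × (u ≡ p ⊎ w ≡ q)
  Fan-elim {u} {w} f with to T-∧ f
  ... | e , atEnd = e , ⊎-map (toWitness {a? = u ≟ p}) (toWitness {a? = w ≟ q}) (to T-∨ atEnd)

  Compl-Fan-elim : ∀ {u w} → T (Compl E (Fan E p q) u w) → T (E u w) × u ≢ p × w ≢ q
  Compl-Fan-elim k with ComplementMembership.Compl-elim E (Fan E p q) k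
  ... | e , ¬f = e , (λ u≡p → ¬f (Fan-intro e (inj₁ u≡p))) , (λ w≡q → ¬f (Fan-intro e (inj₂ w≡q)))

  module _ (epq : T (E p q)) where

    Fan-walkToTail : ∀ {w} → InV (Fan E p q) w → Walk (Fan E p q) w p
    Fan-walkToTail (y , inj₁ f) with Fan-elim f
    ... | _ , inj₁ refl = ε
    ... | _ , inj₂ refl = inj₁ f ◅ inj₂ (Fan-intro epq (inj₁ refl)) ◅ ε
    Fan-walkToTail (y , inj₂ f) with Fan-elim f
    ... | _ , inj₁ refl = inj₂ f ◅ ε
    ... | _ , inj₂ refl = inj₂ (Fan-intro epq (inj₁ refl)) ◅ ε

    Fan-connected : ConnectedSub (Fan E p q)
    Fan-connected u v onU onV = Fan-walkToTail onU ◅◅ Walk-reverse (Fan-walkToTail onV)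

    Fan-vertex : ∀ {w} → InV (Fan E p q) w → T (E w q) ⊎ T (E p w)
    Fan-vertex (y , inj₁ f) with Fan-elim f
    ... | _   , inj₁ refl = inj₁ epq
    ... | ewq , inj₂ refl = inj₁ ewq
    Fan-vertex (y , inj₂ f) with Fan-elim f
    ... | epw , inj₁ refl = inj₂ epw
    ... | _   , inj₂ refl = inj₂ epq

    -- A dynamical region inside the fan contains (p, q) by closure, hence every fan edge.
    Fan-minimal : ∀ R → DynRegion E R → R ⊆E Fan E p q → ∀ u w → R u w ≡ Fan E p q u w
    Fan-minimal R region R⊆F u w = T-extensional (R⊆F u w) F⊆R
      where
      pq∈R : T (R p q)
      pq∈R with proj₁ (proj₂ region)
      ... | x , y , rxy with proj₂ (Fan-elim (R⊆F x y rxy))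
      ...   | inj₁ refl = DynRegion-tailClosed region rxy epq
      ...   | inj₂ refl = DynRegion-headClosed region rxy epq

      F⊆R : T (Fan E p q u w) → T (R u w)
      F⊆R f with Fan-elim f
      ... | euw , inj₁ refl = DynRegion-tailClosed region pq∈R euw
      ... | euw , inj₂ refl = DynRegion-headClosed region pq∈R euw

module _ {n : ℕ} {E : EdgeSet n} (loopless : Loopless E) (mp1 : MP1 E)
         {p q : Fin n} (epq : T (E p q)) where

  open FanEdges {E = E} {p} {q}

  private
    F K : EdgeSet n
    F = Fan E p q
    K = Compl E F

  noComplOutOfTail : ∀ {w y} → T (E w q) → ¬ T (K w y)
  noComplOutOfTail ewq k with Compl-Fan-elim k
  ... | ewy , w≢p , y≢q = noDBrev loopless mp1 ewy ewq epq y≢q w≢p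

  noComplIntoHead : ∀ {w y} → T (E p w) → ¬ T (K y w)
  noComplIntoHead epw k with Compl-Fan-elim k
  ... | eyw , y≢p , w≢q = noDB loopless mp1 eyw epw epq y≢p w≢q

  noFanIntoTail : ∀ {w u} → T (E w q) → w ≢ q → ¬ T (F u w)
  noFanIntoTail ewq w≢q f with Fan-elim f
  ... | epw , inj₁ refl = noTransitiveTriangle loopless mp1 epw ewq epq
  ... | _   , inj₂ w≡q  = w≢q w≡q

  noFanOutOfHead : ∀ {w u} → T (E p w) → w ≢ p → ¬ T (F w u)
  noFanOutOfHead epw w≢p f with Fan-elim f
  ... | _   , inj₁ w≡p  = w≢p w≡p
  ... | ewq , inj₂ refl = noTransitiveTriangle loopless mp1 epw ewq epq

  Fan-boundary : ∀ w → Boundary E F w → Unstable E w × Stable F w × Stable K w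
  Fan-boundary w (onF , onK) with Fan-vertex epq onF | onK
  ... | inj₁ ewq | y , inj₁ kwy = ⊥-elim (noComplOutOfTail ewq kwy)
  ... | inj₂ epw | y , inj₂ kyw = ⊥-elim (noComplIntoHead epw kyw)
  ... | inj₁ ewq | y , inj₂ kyw with Compl-Fan-elim kyw
  ...   | eyw , _ , w≢q = Unstable-through {H = E} eyw ewq
                        , noIn⇒Stable {H = F} (λ u → noFanIntoTail ewq w≢q)
                        , noOut⇒Stable {H = K} (λ u → noComplOutOfTail ewq)
  Fan-boundary w (onF , onK) | inj₂ epw | y , inj₁ kwy with Compl-Fan-elim kwy
  ...   | ewy , w≢p , _ = Unstable-through {H = E} epw ewy
                        , noOut⇒Stable {H = F} (λ u → noFanOutOfHead epw w≢p)
                        , noIn⇒Stable {H = K} (λ u → noComplIntoHead epw)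

  Fan-isDynModule : (Cycle E → ⊥) → DynModule E F
  Fan-isDynModule acyclic = region , Fan-minimal epq
    where
    region : DynRegion E F
    region = (λ u w → proj₁ ∘ Fan-elim) , (p , q , Fan-intro epq (inj₁ refl))
           , Fan-connected epq , Fan-boundary , λ c _ → ⊥-elim (acyclic c)

SharedTailOrHead : ∀ {n} → EdgeSet n → Set
SharedTailOrHead E = ∀ {a b c d} → T (E a b) → T (E c d) → c ≡ a ⊎ d ≡ b

module _ {n : ℕ} {E : EdgeSet n} where

  UniqueDynModule-≗ : UniqueDynModule E → ∀ {R₁ R₂} → DynModule E R₁ → DynModule E R₂ →
                      ∀ u v → R₁ u v ≡ R₂ u v
  UniqueDynModule-≗ (_ , _ , unique) m₁ m₂ u v = trans (unique _ m₁ u v) (sym (unique _ m₂ u v))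

  -- All fans are the same module, so (c, d) lies in the fan of (a, b).
  UniqueDynModule⇒SharedTailOrHead : Loopless E → MP1 E → (Cycle E → ⊥) →
                                     UniqueDynModule E → SharedTailOrHead E
  UniqueDynModule⇒SharedTailOrHead loopless mp1 acyclic unique {a} {b} {c} {d} eab ecd =
    proj₂ (FanEdges.Fan-elim {E = E} {a} {b} cd∈Fan-ab)
    where
    sameFan : Fan E c d c d ≡ Fan E a b c d
    sameFan = UniqueDynModule-≗ unique (Fan-isDynModule loopless mp1 ecd acyclic)
                (Fan-isDynModule loopless mp1 eab acyclic) c d

    cd∈Fan-ab : T (Fan E a b c d)
    cd∈Fan-ab = subst T sameFan (FanEdges.Fan-intro {E = E} ecd (inj₁ refl))

module _ {n : ℕ} {E : EdgeSet n} (loopless : Loopless E) (connected : ConnectedDigraph E) where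

  commonHead⇒IsSinkDigraph : ∀ {q} → (∀ {u w} → T (E u w) → w ≡ q) → IsSinkDigraph E
  commonHead⇒IsSinkDigraph {q} head = q , qSink , onlySink , λ u w e → inj₂ (head e)
    where
    qSink : SinkVertex E q
    qSink w = ¬T⇒≡false λ eqw → Loopless-≢ loopless eqw (sym (head eqw))

    sinkWalkToHead : ∀ {v} → SinkVertex E v → Walk E v q → v ≡ q
    sinkWalkToHead _    ε             = refl
    sinkWalkToHead sink (inj₁ e ◅ _)  = ⊥-elim (≡false⇒¬T (sink _) e)
    sinkWalkToHead _    (inj₂ e ◅ _)  = head e

    onlySink : ∀ v → SinkVertex E v → v ≡ q
    onlySink v sink = sinkWalkToHead sink (connected v q)

module _ {n : ℕ} {E : EdgeSet n} where

  -- Sources of E are the sinks of its reversal.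
  commonTail⇒IsSourceDigraph : Loopless E → ConnectedDigraph E →
                               ∀ {p} → (∀ {u w} → T (E u w) → u ≡ p) → IsSourceDigraph E
  commonTail⇒IsSourceDigraph loopless connected tail
    with commonHead⇒IsSinkDigraph {E = flip E} loopless (λ u v → Walk-flip (connected u v)) tail
  ... | p , source , onlySource , incident = p , source , onlySource , λ u w e → swap (incident w u e)

  SharedTailOrHead⇒IsSink⊎IsSource : Loopless E → ConnectedDigraph E → SharedTailOrHead E →
                                     ∀ {p q} → T (E p q) → IsSinkDigraph E ⊎ IsSourceDigraph E
  SharedTailOrHead⇒IsSink⊎IsSource loopless connected meet {p} {q} epq
    with any? (λ u → T? (E u q) ×-dec ¬? (u ≟ p))
  ... | yes (u , euq , u≢p) = inj₁ (commonHead⇒IsSinkDigraph loopless connected head)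
    where
    head : ∀ {x w} → T (E x w) → w ≡ q
    head exw with meet euq exw | meet epq exw
    ... | inj₂ w≡q | _        = w≡q
    ... | inj₁ _   | inj₂ w≡q = w≡q
    ... | inj₁ x≡u | inj₁ x≡p = ⊥-elim (u≢p (trans (sym x≡u) x≡p))
  ... | no noOtherTailOfQ = inj₂ (commonTail⇒IsSourceDigraph loopless connected tail)
    where
    tail : ∀ {x w} → T (E x w) → x ≡ p
    tail {x} exw with meet epq exw
    ... | inj₁ x≡p = x≡p
    ... | inj₂ refl = decidable-stable (x ≟ p) (λ x≢p → noOtherTailOfQ (x , exw , x≢p))

proposition4p21 : (n : ℕ) (E : EdgeSet n) →
    Loopless E → ConnectedDigraph E → MPDigraph E → ¬ IsCycleDigraph E →
    UniqueDynModule E →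
    IsSinkDigraph E ⊎ IsSourceDigraph E
proposition4p21 _ E loopless connected (mp1 , mp2) notCycle
                unique@(R , ((R⊆E , (p , q , rpq) , _) , _) , _) =
  SharedTailOrHead⇒IsSink⊎IsSource loopless connected meet (R⊆E p q rpq)
  where
  acyclic : Cycle E → ⊥
  acyclic = notCycle ∘ Cycle⇒IsCycleDigraph connected mp2

  meet : SharedTailOrHead E
  meet = UniqueDynModule⇒SharedTailOrHead loopless mp1 acyclic unique
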